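{- Let $n\ge 1$ and $r\ge 1$ be integers, and let $\tau_1,\ldots,\tau_r$ be independent, uniformly random elements of $\mathfrak{M}_n$. Then \[ P(\inf(\tau_1,\ldots,\tau_r)=\tau_{\min}) = P(\sup(\tau_1,\ldots,\tau_r)=\tau_{\max}). \]
   Context: A monotone triangle of size $n$ is a triangular array of integers $\tau=(\tau(i,j))_{1\le j\le i\le n}$, with $i$ entries in row $i$, all entries taken from $[n]=\{1,\ldots,n\}$, such that $\tau(i,j)<\tau(i,j+1)$ and $\tau(i,j)\le \tau(i-1,j)\le \tau(i,j+1)$ whenever $1\le j<i$. (This forces the last row to be $1,2,\ldots,n$.) Let $\mathfrak{M}_n$ be the set of monotone triangles of size $n$. For $\tau_1,\ldots,\tau_r\in\mathfrak{M}_n$, $\inf(\tau_1,\ldots,\tau_r)$ and $\sup(\tau_1,\ldots,\tau_r)$ are the triangles whose $(i,j)$ entries are $\min_k \tau_k(i,j)$ and $\max_k\tau_k(i,j)$ respectively (these are again monotone triangles). $\tau_{\min}$ is the monotone triangle whose row $i$ is $1,2,\ldots,i$ for every $i$, and $\tau_{\max}$ is the monotone triangle whose row $i$ is $n-i+1,n-i+2,\ldots,n$ for every $i$. -}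

module Defs where

open import Data.Nat using (ℕ; zero; suc; _+_; _∸_; _≤_; _<_; _⊓_; _⊔_)
import Data.Nat as ℕ
open import Data.Integer using (+_)
open import Data.Rational using (ℚ; 0ℚ; _/_)
open import Data.List using (List; []; _∷_; length; map; zipWith; applyUpTo; filter; cartesianProductWith)
import Data.List.Properties as LP
open import Data.List.Membership.Propositional using (_∈_)
open import Data.List.Relation.Unary.Unique.Propositional using (Unique)
open import Data.Vec using (Vec; []; _∷_)
open import Data.Product using (_×_)
open import Relation.Binary.PropositionalEquality using (_≡_)
open import Relation.Binary.Definitions using (DecidableEquality)
open import Relation.Unary using (Pred; Decidable)
open import Function.Bundles using (_⇔_)
import Level

-- A triangular array: list of rows, row i (1-based) is the i-th list.
Tri : Set
Tri = List (List ℕ)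

-- 1-based access with default values (only used inside the valid range).
nth : List ℕ → ℕ → ℕ
nth []       _             = 0
nth (x ∷ xs) zero          = 0
nth (x ∷ xs) (suc zero)    = x
nth (x ∷ xs) (suc (suc k)) = nth xs (suc k)

row : Tri → ℕ → List ℕ
row []       _             = []
row (x ∷ xs) zero          = []
row (x ∷ xs) (suc zero)    = x
row (x ∷ xs) (suc (suc k)) = row xs (suc k)

ent : Tri → ℕ → ℕ → ℕ
ent t i j = nth (row t i) j

record IsMT (n : ℕ) (t : Tri) : Set where
  field
    nrows   : length t ≡ n
    rowlen  : ∀ i → 1 ≤ i → i ≤ n → length (row t i) ≡ i
    range   : ∀ i j → 1 ≤ j → j ≤ i → i ≤ n → 1 ≤ ent t i j × ent t i j ≤ n
    strict  : ∀ i j → 1 ≤ j → j < i → i ≤ n → ent t i j < ent t i (suc j)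
    interl  : ∀ i j → 1 ≤ j → j < i → i ≤ n →
              ent t i j ≤ ent t (i ∸ 1) j × ent t (i ∸ 1) j ≤ ent t i (suc j)

meet : Tri → Tri → Tri
meet = zipWith (zipWith _⊓_)

join : Tri → Tri → Tri
join = zipWith (zipWith _⊔_)

-- inf / sup of a tuple (only used for r ≥ 1)
infT : ∀ {r} → Vec Tri r → Tri
infT []                = []
infT (t ∷ [])          = t
infT (t ∷ ts@(_ ∷ _))  = meet t (infT ts)

supT : ∀ {r} → Vec Tri r → Tri
supT []                = []
supT (t ∷ [])          = t
supT (t ∷ ts@(_ ∷ _))  = join t (supT ts)

-- τ_min: row i = 1,2,...,i ;  τ_max: row i = n-i+1,...,n
τmin : ℕ → Tri
τmin n = applyUpTo (λ k → applyUpTo suc (suc k)) n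

τmax : ℕ → Tri
τmax n = applyUpTo (λ k → applyUpTo (λ m → (n ∸ k) + m) (suc k)) n

Enumerates : ℕ → List Tri → Set
Enumerates n L = Unique L × (∀ t → (t ∈ L) ⇔ IsMT n t)

tuples : ∀ {A : Set} (r : ℕ) → List A → List (Vec A r)
tuples zero    L = [] ∷ []
tuples (suc r) L = cartesianProductWith _∷_ L (tuples r L)

ratio : ℕ → ℕ → ℚ
ratio c zero    = 0ℚ
ratio c (suc d) = (+ c) / suc d

-- probability of an event E for r independent uniform draws from the finite set listed by L
prob : (r : ℕ) → List Tri → {E : Pred (Vec Tri r) Level.zero} → Decidable E → ℚ
prob r L E? = ratio (length (filter E? (tuples r L))) (length (tuples r L))

_≟T_ : DecidableEquality Tri
_≟T_ = LP.≡-dec (LP.≡-dec ℕ._≟_)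

infIsMin? : ∀ n r → Decidable (λ (v : Vec Tri r) → infT v ≡ τmin n)
infIsMin? n r v = infT v ≟T τmin n

supIsMax? : ∀ n r → Decidable (λ (v : Vec Tri r) → supT v ≡ τmax n)
supIsMax? n r v = supT v ≟T τmax n

-- The proof is a bijection argument.  The MIRROR of a triangle reverses every
-- row and replaces each entry a by n+1−a:  mirror(τ)(i,j) = n+1−τ(i,i+1−j).
--   (1) mirror maps monotone triangles of size n to monotone triangles of size
--       n and is an involution on them; hence it permutes any enumeration L of
--       𝔐_n, and applying it coordinatewise permutes the list of r-tuples L^r.
--   (2) a ↦ n+1−a exchanges min and max, and rows of equal length stay aligned
--       under reversal, so mirror turns entrywise min into entrywise max:
--       mirror(inf v) = sup(mirror v) and mirror(sup v) = inf(mirror v).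
--   (3) mirror(τ_min) = τ_max, hence also mirror(τ_max) = τ_min.
-- By (2) and (3), inf v = τ_min iff sup(mirror v) = τ_max for every tuple v of
-- monotone triangles, so the two events have equally many witnesses in L^r by
-- (1).
module Submission where

open import Defs
open import Data.Nat using (ℕ; zero; suc; _+_; _∸_; _≤_; _<_; _⊓_; _⊔_; z≤n; s≤s)
open import Data.Nat.Properties
open import Data.List using (List; []; _∷_; length; map; zipWith; applyUpTo; reverse; _++_; [_]; _∷ʳ_; filter; cartesianProductWith)
import Data.List.Properties as LP
open import Data.List.Relation.Unary.All as All using (All; []; _∷_)
import Data.List.Relation.Unary.All.Properties as All
open import Data.List.Relation.Unary.AllPairs using ([]; _∷_)
open import Data.List.Relation.Unary.Unique.Propositional using (Unique)
open import Data.List.Membership.Propositional using (_∈_)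
open import Data.List.Membership.Propositional.Properties using (∈-map⁺; ∈-map⁻)
open import Data.List.Membership.Propositional.Properties.WithK using (unique∧set⇒bag)
open import Data.List.Relation.Binary.BagAndSetEquality using (∼bag⇒↭)
open import Data.List.Relation.Binary.Permutation.Propositional using (_↭_; refl; prep; swap; trans)
import Data.List.Relation.Binary.Permutation.Propositional.Properties as Perm
open import Data.Vec using (Vec; []; _∷_)
import Data.Vec as Vec
open import Data.Vec.Relation.Unary.All as VecAll using ([]; _∷_)
import Data.Vec.Relation.Unary.All.Properties as VecAllP
open import Data.Product using (_×_; _,_; proj₁; proj₂)
open import Data.Sum using (inj₁; inj₂)
open import Data.Empty using (⊥-elim)
open import Function using (_∘_)
open import Function.Bundles using (_⇔_; mk⇔; Equivalence)
open import Relation.Nullary using (yes; no)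
open import Relation.Unary using (Pred; Decidable)
open import Relation.Binary.PropositionalEquality as Eq using (_≡_; _≢_; refl; sym; cong; cong₂; subst; subst₂; module ≡-Reasoning)
import Level

open ≡-Reasoning

nth-suc : ∀ x xs k → 1 ≤ k → nth (x ∷ xs) (suc k) ≡ nth xs k
nth-suc x xs (suc k) _ = refl

nth-map : ∀ (g : ℕ → ℕ) xs j → 1 ≤ j → j ≤ length xs → nth (map g xs) j ≡ g (nth xs j)
nth-map g (x ∷ xs) (suc zero)    _ _       = refl
nth-map g (x ∷ xs) (suc (suc j)) _ (s≤s h) = nth-map g xs (suc j) (s≤s z≤n) h

nth-++ˡ : ∀ xs ys j → 1 ≤ j → j ≤ length xs → nth (xs ++ ys) j ≡ nth xs j
nth-++ˡ (x ∷ xs) ys (suc zero)    _ _       = refl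
nth-++ˡ (x ∷ xs) ys (suc (suc j)) _ (s≤s h) = nth-++ˡ xs ys (suc j) (s≤s z≤n) h

nth-last : ∀ xs x → nth (xs ∷ʳ x) (suc (length xs)) ≡ x
nth-last []       x = refl
nth-last (y ∷ ys) x = nth-last ys x

nth-reverse : ∀ xs j → 1 ≤ j → j ≤ length xs → nth (reverse xs) j ≡ nth xs (suc (length xs) ∸ j)
nth-reverse []       (suc j) _ ()
nth-reverse (x ∷ xs) j 1≤j j≤ with m≤n⇒m<n∨m≡n j≤
... | inj₂ refl = begin
  nth (reverse (x ∷ xs)) (suc (length xs))          ≡⟨ cong (λ ys → nth ys (suc (length xs))) (LP.unfold-reverse x xs) ⟩
  nth (reverse xs ∷ʳ x) (suc (length xs))           ≡⟨ cong (λ k → nth (reverse xs ∷ʳ x) (suc k)) (sym (LP.length-reverse xs)) ⟩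
  nth (reverse xs ∷ʳ x) (suc (length (reverse xs))) ≡⟨ nth-last (reverse xs) x ⟩
  x                                                 ≡⟨ cong (nth (x ∷ xs)) (sym (m+n∸n≡m 1 (length xs))) ⟩
  nth (x ∷ xs) (suc (suc (length xs)) ∸ j)          ∎
... | inj₁ (s≤s j≤L) = begin
  nth (reverse (x ∷ xs)) j                 ≡⟨ cong (λ ys → nth ys j) (LP.unfold-reverse x xs) ⟩
  nth (reverse xs ∷ʳ x) j                  ≡⟨ nth-++ˡ (reverse xs) [ x ] j 1≤j (subst (j ≤_) (sym (LP.length-reverse xs)) j≤L) ⟩
  nth (reverse xs) j                       ≡⟨ nth-reverse xs j 1≤j j≤L ⟩
  nth xs (suc (length xs) ∸ j)             ≡⟨ sym (nth-suc x xs _ (m<n⇒0<n∸m (s≤s j≤L))) ⟩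
  nth (x ∷ xs) (suc (suc (length xs) ∸ j)) ≡⟨ cong (nth (x ∷ xs)) (sym (+-∸-assoc 1 (m≤n⇒m≤1+n j≤L))) ⟩
  nth (x ∷ xs) (suc (suc (length xs)) ∸ j) ∎

nth-applyUpTo : ∀ (g : ℕ → ℕ) m k → k < m → nth (applyUpTo g m) (suc k) ≡ g k
nth-applyUpTo g (suc m) zero    _       = refl
nth-applyUpTo g (suc m) (suc k) (s≤s h) = nth-applyUpTo (g ∘ suc) m k h

nth-ext : ∀ xs ys → length xs ≡ length ys → (∀ j → 1 ≤ j → j ≤ length xs → nth xs j ≡ nth ys j) → xs ≡ ys
nth-ext []       []       _ _ = refl
nth-ext (x ∷ xs) (y ∷ ys) e h =
  cong₂ _∷_ (h 1 (s≤s z≤n) (s≤s z≤n))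
    (nth-ext xs ys (suc-injective e) λ { (suc j) _ j≤ → h (suc (suc j)) (s≤s z≤n) (s≤s j≤) })

all-nth : ∀ {P : ℕ → Set} xs → (∀ j → 1 ≤ j → j ≤ length xs → P (nth xs j)) → All P xs
all-nth []       _ = []
all-nth (x ∷ xs) h = h 1 (s≤s z≤n) (s≤s z≤n) ∷ all-nth xs λ { (suc j) _ j≤ → h (suc (suc j)) (s≤s z≤n) (s≤s j≤) }

all-row : ∀ {P : List ℕ → Set} (t : Tri) → (∀ i → 1 ≤ i → i ≤ length t → P (row t i)) → All P t
all-row []       _ = []
all-row (x ∷ xs) h = h 1 (s≤s z≤n) (s≤s z≤n) ∷ all-row xs λ { (suc i) _ i≤ → h (suc (suc i)) (s≤s z≤n) (s≤s i≤) }

length-row : ∀ t i → length (row t i) ≡ nth (map length t) i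
length-row []       i             = refl
length-row (x ∷ xs) zero          = refl
length-row (x ∷ xs) (suc zero)    = refl
length-row (x ∷ xs) (suc (suc i)) = length-row xs (suc i)

zipWith-++ : ∀ {A B C : Set} {g : A → B → C} xs ys xs′ ys′ → length xs ≡ length ys →
  zipWith g (xs ++ xs′) (ys ++ ys′) ≡ zipWith g xs ys ++ zipWith g xs′ ys′
zipWith-++ []       []       _ _ _ = refl
zipWith-++ (x ∷ xs) (y ∷ ys) xs′ ys′ e = cong (_ ∷_) (zipWith-++ xs ys xs′ ys′ (suc-injective e))

reverse-zipWith : ∀ {A B C : Set} {g : A → B → C} xs ys → length xs ≡ length ys →
  reverse (zipWith g xs ys) ≡ zipWith g (reverse xs) (reverse ys)
reverse-zipWith         []       []       _ = refl
reverse-zipWith {g = g} (x ∷ xs) (y ∷ ys) e = begin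
  reverse (zipWith g (x ∷ xs) (y ∷ ys))                    ≡⟨ LP.unfold-reverse (g x y) (zipWith g xs ys) ⟩
  reverse (zipWith g xs ys) ∷ʳ g x y                       ≡⟨ cong (_∷ʳ g x y) (reverse-zipWith xs ys (suc-injective e)) ⟩
  zipWith g (reverse xs) (reverse ys) ++ [ g x y ]         ≡⟨ sym (zipWith-++ (reverse xs) (reverse ys) [ x ] [ y ] len) ⟩
  zipWith g (reverse xs ∷ʳ x) (reverse ys ∷ʳ y)            ≡⟨ sym (cong₂ (zipWith g) (LP.unfold-reverse x xs) (LP.unfold-reverse y ys)) ⟩
  zipWith g (reverse (x ∷ xs)) (reverse (y ∷ ys))          ∎
  where
  len : length (reverse xs) ≡ length (reverse ys)
  len = Eq.trans (LP.length-reverse xs) (Eq.trans (suc-injective e) (sym (LP.length-reverse ys)))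

applyUpTo-cong : ∀ {A : Set} {f g : ℕ → A} m → (∀ k → k < m → f k ≡ g k) → applyUpTo f m ≡ applyUpTo g m
applyUpTo-cong zero    _ = refl
applyUpTo-cong (suc m) h = cong₂ _∷_ (h 0 (s≤s z≤n)) (applyUpTo-cong m (λ k k<m → h (suc k) (s≤s k<m)))

-- Reflection of values and the mirror of a triangle

reflect-range : ∀ {m a} → 1 ≤ a → a ≤ m → 1 ≤ suc m ∸ a × suc m ∸ a ≤ m
reflect-range {m} 1≤a a≤m = m<n⇒0<n∸m (s≤s a≤m) , ∸-monoʳ-≤ (suc m) 1≤a

mirrorRow : ℕ → List ℕ → List ℕ
mirrorRow n xs = reverse (map (suc n ∸_) xs)

mirror : ℕ → Tri → Tri
mirror n = map (mirrorRow n)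

length-mirrorRow : ∀ n xs → length (mirrorRow n xs) ≡ length xs
length-mirrorRow n xs = Eq.trans (LP.length-reverse (map (suc n ∸_) xs)) (LP.length-map (suc n ∸_) xs)

shape-mirror : ∀ n t → map length (mirror n t) ≡ map length t
shape-mirror n t = Eq.trans (sym (LP.map-∘ t)) (LP.map-cong (length-mirrorRow n) t)

row-mirror : ∀ n t i → row (mirror n t) i ≡ mirrorRow n (row t i)
row-mirror n []       i             = refl
row-mirror n (x ∷ xs) zero          = refl
row-mirror n (x ∷ xs) (suc zero)    = refl
row-mirror n (x ∷ xs) (suc (suc i)) = row-mirror n xs (suc i)

ent-mirror : ∀ n t i j → 1 ≤ j → j ≤ length (row t i) →
  ent (mirror n t) i j ≡ suc n ∸ ent t i (suc (length (row t i)) ∸ j)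
ent-mirror n t i j 1≤j j≤ℓ = begin
  nth (row (mirror n t) i) j                       ≡⟨ cong (λ xs → nth xs j) (row-mirror n t i) ⟩
  nth (reverse (map (suc n ∸_) r)) j               ≡⟨ nth-reverse (map (suc n ∸_) r) j 1≤j (subst (j ≤_) (sym ℓ-map) j≤ℓ) ⟩
  nth (map (suc n ∸_) r) (suc (length (map (suc n ∸_) r)) ∸ j)
                                                   ≡⟨ cong (λ ℓ → nth (map (suc n ∸_) r) (suc ℓ ∸ j)) ℓ-map ⟩
  nth (map (suc n ∸_) r) (suc (length r) ∸ j)      ≡⟨ nth-map (suc n ∸_) r _ (proj₁ (reflect-range 1≤j j≤ℓ)) (proj₂ (reflect-range 1≤j j≤ℓ)) ⟩
  suc n ∸ nth r (suc (length r) ∸ j)               ∎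
  where
  r : List ℕ
  r = row t i
  ℓ-map : length (map (suc n ∸_) r) ≡ length r
  ℓ-map = LP.length-map (suc n ∸_) r

mirrorRow-involutive : ∀ n xs → All (_≤ suc n) xs → mirrorRow n (mirrorRow n xs) ≡ xs
mirrorRow-involutive n xs bounded = begin
  reverse (map c (reverse (map c xs))) ≡⟨ cong reverse (LP.reverse-map c (map c xs)) ⟩
  reverse (reverse (map c (map c xs))) ≡⟨ LP.reverse-involutive (map c (map c xs)) ⟩
  map c (map c xs)                     ≡⟨ sym (LP.map-∘ xs) ⟩
  map (c ∘ c) xs                       ≡⟨ LP.map-id-local (All.map m∸[m∸n]≡n bounded) ⟩
  xs                                   ∎
  where
  c : ℕ → ℕ
  c = suc n ∸_

mirror-involutive : ∀ n t → All (All (_≤ suc n)) t → mirror n (mirror n t) ≡ t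
mirror-involutive n t bounded =
  Eq.trans (sym (LP.map-∘ t)) (LP.map-id-local (All.map (mirrorRow-involutive n _) bounded))

module MirrorZip (n : ℕ) (f h : ℕ → ℕ → ℕ) (compl : ∀ a b → suc n ∸ f a b ≡ h (suc n ∸ a) (suc n ∸ b)) where

  mirrorRow-zipWith : ∀ xs ys → length xs ≡ length ys →
    mirrorRow n (zipWith f xs ys) ≡ zipWith h (mirrorRow n xs) (mirrorRow n ys)
  mirrorRow-zipWith xs ys e = begin
    reverse (map (suc n ∸_) (zipWith f xs ys))                          ≡⟨ cong reverse (LP.map-zipWith f (suc n ∸_) xs ys) ⟩
    reverse (zipWith (λ a b → suc n ∸ f a b) xs ys)                     ≡⟨ cong reverse (LP.zipWith-cong compl xs ys) ⟩
    reverse (zipWith (λ a b → h (suc n ∸ a) (suc n ∸ b)) xs ys)         ≡⟨ cong reverse (sym (LP.zipWith-map h (suc n ∸_) (suc n ∸_) xs ys)) ⟩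
    reverse (zipWith h (map (suc n ∸_) xs) (map (suc n ∸_) ys))         ≡⟨ reverse-zipWith (map (suc n ∸_) xs) (map (suc n ∸_) ys) len ⟩
    zipWith h (mirrorRow n xs) (mirrorRow n ys)                         ∎
    where
    len : length (map (suc n ∸_) xs) ≡ length (map (suc n ∸_) ys)
    len = Eq.trans (LP.length-map _ xs) (Eq.trans e (sym (LP.length-map _ ys)))

  mirror-zipWith : ∀ a b → map length a ≡ map length b →
    mirror n (zipWith (zipWith f) a b) ≡ zipWith (zipWith h) (mirror n a) (mirror n b)
  mirror-zipWith []       []       _ = refl
  mirror-zipWith (x ∷ a) (y ∷ b) e =
    cong₂ _∷_ (mirrorRow-zipWith x y (LP.∷-injectiveˡ e)) (mirror-zipWith a b (LP.∷-injectiveʳ e))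

-- Complementation exchanges ⊓ and ⊔, so the mirror exchanges meet and join.
mirror-meet : ∀ n a b → map length a ≡ map length b → mirror n (meet a b) ≡ join (mirror n a) (mirror n b)
mirror-meet n = MirrorZip.mirror-zipWith n _⊓_ _⊔_ (∸-distribˡ-⊓-⊔ (suc n))

mirror-join : ∀ n a b → map length a ≡ map length b → mirror n (join a b) ≡ meet (mirror n a) (mirror n b)
mirror-join n = MirrorZip.mirror-zipWith n _⊔_ _⊓_ (∸-distribˡ-⊔-⊓ (suc n))

-- Monotone triangles: shape, bounds, and invariance under the mirror

shape : ℕ → List ℕ
shape n = applyUpTo suc n

module _ {n : ℕ} {t : Tri} (mt : IsMT n t) where
  open IsMT mt

  -- A monotone triangle of size n has the shape of size n, and its entries are
  -- at most n+1 (indeed in [1,n]), which is what the involution lemma needs.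
  mt-shape : map length t ≡ shape n
  mt-shape = nth-ext (map length t) (shape n)
    (Eq.trans (LP.length-map length t) (Eq.trans nrows (sym (LP.length-applyUpTo suc n)))) same
    where
    same : ∀ j → 1 ≤ j → j ≤ length (map length t) → nth (map length t) j ≡ nth (shape n) j
    same (suc j) 1≤j j≤ = begin
      nth (map length t) (suc j) ≡⟨ sym (length-row t (suc j)) ⟩
      length (row t (suc j))     ≡⟨ rowlen (suc j) 1≤j j<n ⟩
      suc j                      ≡⟨ sym (nth-applyUpTo suc n j j<n) ⟩
      nth (shape n) (suc j)      ∎
      where
      j<n : j < n
      j<n = subst (suc j ≤_) (Eq.trans (LP.length-map length t) nrows) j≤

  mt-bounded : All (All (_≤ suc n)) t
  mt-bounded = all-row t λ i 1≤i i≤ → let i≤n = subst (i ≤_) nrows i≤ in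
    all-nth (row t i) λ j 1≤j j≤ →
      m≤n⇒m≤1+n (proj₂ (range i j 1≤j (subst (j ≤_) (rowlen i 1≤i i≤n) j≤) i≤n))

  mirror-entry : ∀ i j → 1 ≤ j → j ≤ i → i ≤ n → ent (mirror n t) i j ≡ suc n ∸ ent t i (suc i ∸ j)
  mirror-entry i j 1≤j j≤i i≤n = Eq.trans (ent-mirror n t i j 1≤j (subst (j ≤_) (sym ℓ) j≤i))
                                          (cong (λ m → suc n ∸ ent t i (suc m ∸ j)) ℓ)
    where
    ℓ : length (row t i) ≡ i
    ℓ = rowlen i (≤-trans 1≤j j≤i) i≤n

  -- For j < i the reflected position of j is 1 + (i − j), of j+1 it is i − j.
  mirror-entry< : ∀ i j → 1 ≤ j → j < i → i ≤ n → ent (mirror n t) i j ≡ suc n ∸ ent t i (suc (i ∸ j))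
  mirror-entry< i j 1≤j j<i i≤n = Eq.trans (mirror-entry i j 1≤j (<⇒≤ j<i) i≤n)
                                           (cong (λ k → suc n ∸ ent t i k) (+-∸-assoc 1 (<⇒≤ j<i)))

  -- The mirror of a monotone triangle is a monotone triangle: reflection of
  -- positions and complementation of values both reverse order, so strict
  -- increase along rows and interlacing between rows are preserved.
  mirror-MT : IsMT n (mirror n t)
  mirror-MT = record
    { nrows  = Eq.trans (LP.length-map (mirrorRow n) t) nrows
    ; rowlen = λ i 1≤i i≤n → Eq.trans (cong length (row-mirror n t i))
                                       (Eq.trans (length-mirrorRow n (row t i)) (rowlen i 1≤i i≤n))
    ; range  = ranged
    ; strict = increasing
    ; interl = interlacing
    }
    where
    ranged : ∀ i j → 1 ≤ j → j ≤ i → i ≤ n → 1 ≤ ent (mirror n t) i j × ent (mirror n t) i j ≤ n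
    ranged i j 1≤j j≤i i≤n rewrite mirror-entry i j 1≤j j≤i i≤n =
      let (1≤k , k≤i) = reflect-range 1≤j j≤i
          (1≤a , a≤n) = range i (suc i ∸ j) 1≤k k≤i i≤n
      in reflect-range 1≤a a≤n

    module Reflected (i j : ℕ) (1≤j : 1 ≤ j) (j<i : j < i) where
      pos-1≤ : 1 ≤ i ∸ j
      pos-1≤ = m<n⇒0<n∸m j<i
      pos-suc≤ : suc (i ∸ j) ≤ i
      pos-suc≤ = subst (_≤ i) (+-∸-assoc 1 (<⇒≤ j<i)) (proj₂ (reflect-range 1≤j (<⇒≤ j<i)))

    increasing : ∀ i j → 1 ≤ j → j < i → i ≤ n → ent (mirror n t) i j < ent (mirror n t) i (suc j)
    increasing i j 1≤j j<i i≤n =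
      subst₂ _<_ (sym (mirror-entry< i j 1≤j j<i i≤n)) (sym (mirror-entry i (suc j) (s≤s z≤n) j<i i≤n))
        (∸-monoʳ-< (strict i (i ∸ j) pos-1≤ pos-suc≤ i≤n)
                   (m≤n⇒m≤1+n (proj₂ (range i (suc (i ∸ j)) (s≤s z≤n) pos-suc≤ i≤n))))
      where open Reflected i j 1≤j j<i

    interlacing : ∀ i j → 1 ≤ j → j < i → i ≤ n →
      ent (mirror n t) i j ≤ ent (mirror n t) (i ∸ 1) j × ent (mirror n t) (i ∸ 1) j ≤ ent (mirror n t) i (suc j)
    interlacing i@(suc i′) j 1≤j j<i@(s≤s j≤i′) i≤n =
      let (below , above) = interl i (i ∸ j) pos-1≤ pos-suc≤ i≤n
      in  subst₂ _≤_ (sym here) (sym up) (∸-monoʳ-≤ (suc n) above)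
        , subst₂ _≤_ (sym up) (sym next) (∸-monoʳ-≤ (suc n) below)
      where
      open Reflected i j 1≤j j<i
      here : ent (mirror n t) i j ≡ suc n ∸ ent t i (suc (i ∸ j))
      here = mirror-entry< i j 1≤j j<i i≤n
      up : ent (mirror n t) i′ j ≡ suc n ∸ ent t i′ (i ∸ j)
      up = mirror-entry i′ j 1≤j j≤i′ (≤-trans (n≤1+n i′) i≤n)
      next : ent (mirror n t) i (suc j) ≡ suc n ∸ ent t i (i ∸ j)
      next = mirror-entry i (suc j) (s≤s z≤n) j<i i≤n

  mirror-mirror : mirror n (mirror n t) ≡ t
  mirror-mirror = mirror-involutive n t mt-bounded

unique-map-local : ∀ {A B : Set} {P : A → Set} (f : A → B) → (∀ {x y} → P x → P y → f x ≡ f y → x ≡ y) →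
  ∀ {xs} → All P xs → Unique xs → Unique (map f xs)
unique-map-local f inj {[]}     []         []       = []
unique-map-local {P = P} f inj {x ∷ xs} (px ∷ pxs) (d ∷ ds) = distinct pxs d ∷ unique-map-local f inj pxs ds
  where
  distinct : ∀ {ys} → All P ys → All (x ≢_) ys → All (f x ≢_) (map f ys)
  distinct []         []         = []
  distinct (py ∷ pys) (d′ ∷ ds′) = (λ e → d′ (inj px py e)) ∷ distinct pys ds′

-- Since mirror is an involution of 𝔐_n, it permutes every duplicate-free enumeration of 𝔐_n.
mirror-permutes : ∀ n L → Enumerates n L → map (mirror n) L ↭ L
mirror-permutes n L (unique , member) =
  ∼bag⇒↭ (unique∧set⇒bag (unique-map-local (mirror n) injective (All.tabulate toMT) unique) unique (mk⇔ into onto))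
  where
  toMT : ∀ {t} → t ∈ L → IsMT n t
  toMT {t} = Equivalence.to (member t)
  fromMT : ∀ {t} → IsMT n t → t ∈ L
  fromMT {t} = Equivalence.from (member t)
  injective : ∀ {s t} → IsMT n s → IsMT n t → mirror n s ≡ mirror n t → s ≡ t
  injective ms mt e = Eq.trans (sym (mirror-mirror ms)) (Eq.trans (cong (mirror n) e) (mirror-mirror mt))
  into : ∀ {t} → t ∈ map (mirror n) L → t ∈ L
  into t∈ with ∈-map⁻ (mirror n) t∈
  ... | s , s∈ , refl = fromMT (mirror-MT (toMT s∈))
  onto : ∀ {t} → t ∈ L → t ∈ map (mirror n) L
  onto t∈ = subst (_∈ map (mirror n) L) (mirror-mirror (toMT t∈)) (∈-map⁺ (mirror n) (fromMT (mirror-MT (toMT t∈))))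

-- The extremal triangles

reverse-countdown : ∀ c k → reverse (applyUpTo (λ m → (c + k) ∸ m) (suc k)) ≡ applyUpTo (c +_) (suc k)
reverse-countdown c zero    = refl
reverse-countdown c (suc k) = begin
  reverse (applyUpTo down (suc (suc k)))                  ≡⟨ cong reverse (sym (LP.applyUpTo-∷ʳ down (suc k))) ⟩
  reverse (applyUpTo down (suc k) ∷ʳ down (suc k))        ≡⟨ LP.reverse-++ (applyUpTo down (suc k)) [ down (suc k) ] ⟩
  down (suc k) ∷ reverse (applyUpTo down (suc k))         ≡⟨ cong₂ _∷_ (m+n∸n≡m c (suc k))
                                                               (cong (λ m → reverse (applyUpTo (m ∸_) (suc k))) (+-suc c k)) ⟩
  c ∷ reverse (applyUpTo (λ m → (suc c + k) ∸ m) (suc k)) ≡⟨ cong (c ∷_) (reverse-countdown (suc c) k) ⟩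
  c ∷ applyUpTo (suc c +_) (suc k)                        ≡⟨ cong₂ _∷_ (sym (+-identityʳ c))
                                                               (applyUpTo-cong (suc k) (λ m _ → sym (+-suc c m))) ⟩
  applyUpTo (c +_) (suc (suc k))                          ∎
  where
  down : ℕ → ℕ
  down m = (c + suc k) ∸ m

-- Row k (0-based) of τ_min is 1,…,k+1; its mirror is n−k,…,n, row k of τ_max.
mirror-τmin : ∀ n → mirror n (τmin n) ≡ τmax n
mirror-τmin n = Eq.trans (LP.map-applyUpTo _ (mirrorRow n) n) (applyUpTo-cong n mirrored-row)
  where
  mirrored-row : ∀ k → k < n → mirrorRow n (applyUpTo suc (suc k)) ≡ applyUpTo ((n ∸ k) +_) (suc k)
  mirrored-row k k<n = begin
    reverse (map (suc n ∸_) (applyUpTo suc (suc k)))     ≡⟨ cong reverse (LP.map-applyUpTo suc (suc n ∸_) (suc k)) ⟩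
    reverse (applyUpTo (n ∸_) (suc k))                   ≡⟨ cong (λ m → reverse (applyUpTo (m ∸_) (suc k))) (sym (m∸n+n≡m (<⇒≤ k<n))) ⟩
    reverse (applyUpTo (((n ∸ k) + k) ∸_) (suc k))       ≡⟨ reverse-countdown (n ∸ k) k ⟩
    applyUpTo ((n ∸ k) +_) (suc k)                       ∎

-- τ_min has entries in [1,n], so mirroring twice returns it; this gives mirror(τ_max) = τ_min.
τmin-bounded : ∀ n → All (All (_≤ suc n)) (τmin n)
τmin-bounded n = All.applyUpTo⁺₁ _ n λ {k} k<n → All.applyUpTo⁺₁ suc (suc k) λ i<1+k → m≤n⇒m≤1+n (≤-trans i<1+k k<n)

mirror-τmax : ∀ n → mirror n (τmax n) ≡ τmin n
mirror-τmax n = Eq.trans (cong (mirror n) (sym (mirror-τmin n))) (mirror-involutive n (τmin n) (τmin-bounded n))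

-- inf and sup of tuples

zipWith-shape : ∀ (f : ℕ → ℕ → ℕ) a b → map length a ≡ map length b → map length (zipWith (zipWith f) a b) ≡ map length a
zipWith-shape f []      []      _ = refl
zipWith-shape f (x ∷ a) (y ∷ b) e =
  cong₂ _∷_ (Eq.trans (LP.length-zipWith f x y) (Eq.trans (cong (length x ⊓_) (sym (LP.∷-injectiveˡ e))) (⊓-idem (length x))))
            (zipWith-shape f a b (LP.∷-injectiveʳ e))

module _ {S : List ℕ} where
  HasShape : Tri → Set
  HasShape t = map length t ≡ S

  infT-shape : ∀ {r} (v : Vec Tri (suc r)) → VecAll.All HasShape v → HasShape (infT v)
  infT-shape (t ∷ [])     (p ∷ [])     = p
  infT-shape (t ∷ u ∷ us) (p ∷ ps) = Eq.trans (zipWith-shape _⊓_ t _ (Eq.trans p (sym (infT-shape (u ∷ us) ps)))) p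

  supT-shape : ∀ {r} (v : Vec Tri (suc r)) → VecAll.All HasShape v → HasShape (supT v)
  supT-shape (t ∷ [])     (p ∷ [])     = p
  supT-shape (t ∷ u ∷ us) (p ∷ ps) = Eq.trans (zipWith-shape _⊔_ t _ (Eq.trans p (sym (supT-shape (u ∷ us) ps)))) p

  mirror-infT : ∀ n {r} (v : Vec Tri (suc r)) → VecAll.All HasShape v → mirror n (infT v) ≡ supT (Vec.map (mirror n) v)
  mirror-infT n (t ∷ [])     (p ∷ [])     = refl
  mirror-infT n (t ∷ u ∷ us) (p ∷ ps) =
    Eq.trans (mirror-meet n t _ (Eq.trans p (sym (infT-shape (u ∷ us) ps)))) (cong (join (mirror n t)) (mirror-infT n (u ∷ us) ps))

  mirror-supT : ∀ n {r} (v : Vec Tri (suc r)) → VecAll.All HasShape v → mirror n (supT v) ≡ infT (Vec.map (mirror n) v)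
  mirror-supT n (t ∷ [])     (p ∷ [])     = refl
  mirror-supT n (t ∷ u ∷ us) (p ∷ ps) =
    Eq.trans (mirror-join n t _ (Eq.trans p (sym (supT-shape (u ∷ us) ps)))) (cong (meet (mirror n t)) (mirror-supT n (u ∷ us) ps))

mirror-mirror-tuple : ∀ {n r} {v : Vec Tri r} → VecAll.All (IsMT n) v → Vec.map (mirror n) (Vec.map (mirror n) v) ≡ v
mirror-mirror-tuple []         = refl
mirror-mirror-tuple (mt ∷ mts) = cong₂ _∷_ (mirror-mirror mt) (mirror-mirror-tuple mts)

inf-sup-dual : ∀ n {r} (v : Vec Tri (suc r)) → VecAll.All (IsMT n) v →
  (infT v ≡ τmin n) ⇔ (supT (Vec.map (mirror n) v) ≡ τmax n)
inf-sup-dual n v mts = mk⇔ to from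
  where
  shaped : VecAll.All (HasShape {shape n}) v
  shaped = VecAll.map mt-shape mts
  shaped-mirrored : VecAll.All (HasShape {shape n}) (Vec.map (mirror n) v)
  shaped-mirrored = VecAllP.map⁺ (VecAll.map (λ {t} mt → Eq.trans (shape-mirror n t) (mt-shape mt)) mts)
  to : infT v ≡ τmin n → supT (Vec.map (mirror n) v) ≡ τmax n
  to e = begin
    supT (Vec.map (mirror n) v) ≡⟨ sym (mirror-infT n v shaped) ⟩
    mirror n (infT v)           ≡⟨ cong (mirror n) e ⟩
    mirror n (τmin n)           ≡⟨ mirror-τmin n ⟩
    τmax n                      ∎
  from : supT (Vec.map (mirror n) v) ≡ τmax n → infT v ≡ τmin n
  from e = begin
    infT v                                             ≡⟨ cong infT (sym (mirror-mirror-tuple mts)) ⟩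
    infT (Vec.map (mirror n) (Vec.map (mirror n) v))   ≡⟨ sym (mirror-supT n (Vec.map (mirror n) v) shaped-mirrored) ⟩
    mirror n (supT (Vec.map (mirror n) v))             ≡⟨ cong (mirror n) e ⟩
    mirror n (τmax n)                                  ≡⟨ mirror-τmax n ⟩
    τmin n                                             ∎

-- Counting over tuples

count-map : ∀ {A B : Set} {P : Pred A Level.zero} {Q : Pred B Level.zero} (P? : Decidable P) (Q? : Decidable Q)
  (F : A → B) xs → All (λ x → P x ⇔ Q (F x)) xs → length (filter P? xs) ≡ length (filter Q? (map F xs))
count-map P? Q? F []       []         = refl
count-map P? Q? F (x ∷ xs) (e ∷ es) with P? x | Q? (F x)
... | yes _ | yes _  = cong suc (count-map P? Q? F xs es)
... | yes p | no ¬q  = ⊥-elim (¬q (Equivalence.to e p))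
... | no ¬p | yes q  = ⊥-elim (¬p (Equivalence.from e q))
... | no _  | no _   = count-map P? Q? F xs es

tuples-All : ∀ {A : Set} {P : A → Set} r (L : List A) → All P L → All (VecAll.All P) (tuples r L)
tuples-All zero    L _   = [] ∷ []
tuples-All {P = P} (suc r) L pL = go L pL
  where
  go : ∀ xs → All P xs → All (VecAll.All P) (cartesianProductWith Vec._∷_ xs (tuples r L))
  go []       []         = []
  go (x ∷ xs) (px ∷ pxs) = All.++⁺ (All.map⁺ (All.map (px ∷_) (tuples-All r L pL))) (go xs pxs)

map-tuples : ∀ {A : Set} (f : A → A) r (L : List A) → map (Vec.map f) (tuples r L) ≡ tuples r (map f L)
map-tuples f zero    L = refl
map-tuples {A} f (suc r) L = Eq.trans (go L) (cong (cartesianProductWith Vec._∷_ (map f L)) (map-tuples f r L))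
  where
  T : List (Vec A r)
  T = tuples r L
  go : ∀ xs → map (Vec.map f) (cartesianProductWith Vec._∷_ xs T) ≡ cartesianProductWith Vec._∷_ (map f xs) (map (Vec.map f) T)
  go []       = refl
  go (x ∷ xs) = Eq.trans (LP.map-++ (Vec.map f) (map (x ∷_) T) _)
    (cong₂ _++_ (Eq.trans (sym (LP.map-∘ T)) (LP.map-∘ T)) (go xs))

tuples-↭ : ∀ {A : Set} r {L L′ : List A} → L ↭ L′ → tuples r L ↭ tuples r L′
tuples-↭ zero    _ = refl
tuples-↭ (suc r) {L} {L′} p = trans (first-coordinate (tuples r L) p) (rest-coordinates L′ (tuples-↭ r p))
  where
  first-coordinate : ∀ {xs xs′} (T : List (Vec _ r)) → xs ↭ xs′ →
    cartesianProductWith Vec._∷_ xs T ↭ cartesianProductWith Vec._∷_ xs′ T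
  first-coordinate T refl         = refl
  first-coordinate T (prep x q)   = Perm.++⁺ˡ (map (x ∷_) T) (first-coordinate T q)
  first-coordinate T (swap x y q) = trans (Perm.shifts (map (x ∷_) T) (map (y ∷_) T))
    (Perm.++⁺ˡ (map (y ∷_) T) (Perm.++⁺ˡ (map (x ∷_) T) (first-coordinate T q)))
  first-coordinate T (trans q q′) = trans (first-coordinate T q) (first-coordinate T q′)
  rest-coordinates : ∀ xs {T T′ : List (Vec _ r)} → T ↭ T′ →
    cartesianProductWith Vec._∷_ xs T ↭ cartesianProductWith Vec._∷_ xs T′
  rest-coordinates []       q = refl
  rest-coordinates (x ∷ xs) q = Perm.++⁺ (Perm.map⁺ (x ∷_) q) (rest-coordinates xs q)

mirror-permutes-tuples : ∀ n r L → Enumerates n L → map (Vec.map (mirror n)) (tuples r L) ↭ tuples r L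
mirror-permutes-tuples n r L enum =
  subst (_↭ tuples r L) (sym (map-tuples (mirror n) r L)) (tuples-↭ r (mirror-permutes n L enum))

-- The theorem: mirroring coordinatewise carries the inf-event onto the sup-event
-- and permutes the sample space, so both events have the same number of outcomes.
mainTheorem1 : (n r : ℕ) → 1 ≤ n → 1 ≤ r → (L : List Tri) → Enumerates n L →
    prob r L (infIsMin? n r) ≡ prob r L (supIsMax? n r)
mainTheorem1 n (suc r) _ _ L enum@(_ , member) = cong (λ k → ratio k (length T)) (begin
  length (filter (infIsMin? n (suc r)) T)                               ≡⟨ count-map _ _ (Vec.map (mirror n)) T dual ⟩
  length (filter (supIsMax? n (suc r)) (map (Vec.map (mirror n)) T))   ≡⟨ Perm.↭-length (Perm.filter-↭ _ (mirror-permutes-tuples n (suc r) L enum)) ⟩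
  length (filter (supIsMax? n (suc r)) T)                               ∎)
  where
  T : List (Vec Tri (suc r))
  T = tuples (suc r) L
  dual : All (λ v → (infT v ≡ τmin n) ⇔ (supT (Vec.map (mirror n) v) ≡ τmax n)) T
  dual = All.map (inf-sup-dual n _) (tuples-All (suc r) L (All.tabulate λ {t} → Equivalence.to (member t)))
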